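{- Let $v \equiv 2 \pmod 6$ and let $(V,\mathcal{B})$ be an $\mathrm{SQS}(v)$. Suppose that $\mathcal{B}$ can be partitioned into $\frac{v-2}{6}$ pairwise disjoint subsets, $\mathcal{B}=\bigcup_{h=1}^{(v-2)/6}\mathcal{B}_h$, such that each $(V,\mathcal{B}_h)$ is a $2$-$(v,4,3)$ design that admits a completely uniform nested pairing. Then the SQS $(V,\mathcal{B})$ also admits a completely uniform nested pairing.
   Context: An $\mathrm{SQS}(v)$ (Steiner quadruple system) is a pair $(V,\mathcal{B})$ with $|V|=v$ and $\mathcal{B}$ a collection of $4$-subsets (blocks) such that every $3$-subset of $V$ lies in exactly one block. A $2$-$(v,4,\lambda)$ design is a pair $(V,\mathcal{B})$ with $\mathcal{B}$ a collection of $4$-subsets such that every $2$-subset of $V$ lies in exactly $\lambda$ blocks. A nested pairing of a design $(V,\mathcal{B})$ with block size $4$ consists of a choice, for each block $\{x,y,z,w\}\in\mathcal{B}$, of a partition of it into two pairs $\{x,y\mid z,w\}$; the resulting set of nested blocks is a nested design. The multiplicity of a pair $\{x,y\}\in\binom{V}{2}$ is the number of nested blocks having $\{x,y\}$ as one of their two pairs. The nested pairing is completely uniform if all pairs in $\binom{V}{2}$ have the same positive multiplicity. -}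

module Defs where

open import Data.Nat using (ℕ; _<_)
open import Data.Nat.DivMod using (_/_; _%_)
open import Data.Bool using (Bool)
open import Data.Bool.Properties using () renaming (_≟_ to _≟ᵇ_)
open import Data.Fin using (Fin)
open import Data.Fin.Subset using (Subset; _∈_; ∣_∣; ⁅_⁆; _∪_; _∩_; ⊥)
open import Data.Fin.Subset.Properties using (_∈?_)
open import Data.Vec.Properties using (≡-dec)
open import Data.List using (List; length; filter; map; concat)
open import Data.List.Relation.Unary.All using (All)
open import Data.List.Relation.Binary.Permutation.Propositional using (_↭_)
open import Data.Product using (_×_; _,_; proj₁; proj₂; Σ; ∃)
open import Data.Sum using (_⊎_)
open import Relation.Nullary using (¬_)
open import Relation.Nullary.Decidable using (_×-dec_; _⊎-dec_)
open import Relation.Binary.PropositionalEquality using (_≡_)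
open import Relation.Binary.Definitions using (DecidableEquality)

-- The point set V is Fin v.  A block is a subset of Fin v (Data.Fin.Subset);
-- a design is a finite list of blocks (a list, so repeated blocks are allowed,
-- i.e. B is a multiset in general).

_≟ˢ_ : ∀ {v} → DecidableEquality (Subset v)
_≟ˢ_ = ≡-dec _≟ᵇ_

BlockSize4 : ∀ {v} → List (Subset v) → Set
BlockSize4 B = All (λ b → ∣ b ∣ ≡ 4) B

count3 : ∀ {v} → List (Subset v) → Fin v → Fin v → Fin v → ℕ
count3 B x y z = length (filter (λ b → (x ∈? b) ×-dec ((y ∈? b) ×-dec (z ∈? b))) B)

count2 : ∀ {v} → List (Subset v) → Fin v → Fin v → ℕ
count2 B x y = length (filter (λ b → (x ∈? b) ×-dec (y ∈? b)) B)

IsSQS : (v : ℕ) → List (Subset v) → Set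
IsSQS v B = BlockSize4 B ×
  (∀ (x y z : Fin v) → ¬ x ≡ y → ¬ x ≡ z → ¬ y ≡ z → count3 B x y z ≡ 1)

Is2Design : (v λ' : ℕ) → List (Subset v) → Set
Is2Design v λ' B = BlockSize4 B ×
  (∀ (x y : Fin v) → ¬ x ≡ y → count2 B x y ≡ λ')

NestedBlock : ℕ → Set
NestedBlock v = Subset v × Subset v

ValidNested : ∀ {v} → NestedBlock v → Set
ValidNested (P , Q) = ∣ P ∣ ≡ 2 × ∣ Q ∣ ≡ 2 × P ∩ Q ≡ ⊥

underlying : ∀ {v} → NestedBlock v → Subset v
underlying (P , Q) = P ∪ Q

IsNestedPairing : ∀ {v} → List (Subset v) → List (NestedBlock v) → Set
IsNestedPairing B N = All ValidNested N × map underlying N ≡ B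

pair : ∀ {v} → Fin v → Fin v → Subset v
pair x y = ⁅ x ⁆ ∪ ⁅ y ⁆

multiplicity : ∀ {v} → List (NestedBlock v) → Fin v → Fin v → ℕ
multiplicity N x y =
  length (filter (λ pq → (proj₁ pq ≟ˢ pair x y) ⊎-dec (proj₂ pq ≟ˢ pair x y)) N)

CompletelyUniform : ∀ {v} → List (NestedBlock v) → Set
CompletelyUniform {v} N =
  Σ ℕ λ m → 0 < m × (∀ (x y : Fin v) → ¬ x ≡ y → multiplicity N x y ≡ m)

AdmitsCUNestedPairing : ∀ {v} → List (Subset v) → Set
AdmitsCUNestedPairing {v} B =
  Σ (List (NestedBlock v)) λ N → IsNestedPairing B N × CompletelyUniform N

{-# OPTIONS --safe #-}
module Submission where

-- Multiplicities of pairs are additive over concatenation of nested designs and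
-- invariant under reordering, so the nested pairings of the classes B_h glue to a
-- nested pairing of B whose multiplicity is the sum of theirs.  Only the
-- nonemptiness of the partition matters (an SQS(v) with v > 2 has blocks).

open import Defs
open import Data.Nat using (ℕ; _<_; _∸_; _+_; suc; s≤s)
open import Data.Nat.Properties using (+-mono-<)
open import Data.Nat.DivMod using (_/_; _%_)
open import Data.Fin using (Fin; zero; suc)
open import Data.Fin.Subset using (Subset)
open import Data.List using (List; []; _∷_; _++_; length; concat; filter)
open import Data.List.Properties using (length-++; filter-++; map-++; ++-identityʳ)
open import Data.List.Relation.Unary.All as All using (All; []; _∷_)
open import Data.List.Relation.Unary.All.Properties using (++⁺)
open import Data.List.Relation.Binary.Permutation.Propositional using (_↭_; ↭-sym; ↭-trans; ↭-reflexive)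
open import Data.List.Relation.Binary.Permutation.Propositional.Properties
  using (↭-map-inv; ↭-empty-inv; All-resp-↭; filter-↭; ↭-length)
open import Data.Product using (_×_; _,_; proj₂)
open import Data.Empty using (⊥-elim)
open import Relation.Nullary using (¬_)
open import Relation.Binary.PropositionalEquality using (_≡_; refl; sym; trans; cong; cong₂; subst)

multiplicity-++ : ∀ {v} (N M : List (NestedBlock v)) (x y : Fin v) →
  multiplicity (N ++ M) x y ≡ multiplicity N x y + multiplicity M x y
multiplicity-++ N M x y = trans (cong length (filter-++ _ N M)) (length-++ (filter _ N))

multiplicity-resp-↭ : ∀ {v} {N M : List (NestedBlock v)} → N ↭ M → (x y : Fin v) →
  multiplicity N x y ≡ multiplicity M x y
multiplicity-resp-↭ N↭M x y = ↭-length (filter-↭ _ N↭M)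

IsNestedPairing-++ : ∀ {v} {B C : List (Subset v)} {N M : List (NestedBlock v)} →
  IsNestedPairing B N → IsNestedPairing C M → IsNestedPairing (B ++ C) (N ++ M)
IsNestedPairing-++ {N = N} {M} (validN , N⇒B) (validM , M⇒C) =
  ++⁺ validN validM , trans (map-++ underlying N M) (cong₂ _++_ N⇒B M⇒C)

AdmitsCUNestedPairing-++ : ∀ {v} {B C : List (Subset v)} →
  AdmitsCUNestedPairing B → AdmitsCUNestedPairing C → AdmitsCUNestedPairing (B ++ C)
AdmitsCUNestedPairing-++ (N , pairingN , m , 0<m , uniformN) (M , pairingM , k , 0<k , uniformM) =
  N ++ M , IsNestedPairing-++ pairingN pairingM , m + k , +-mono-< 0<m 0<k ,
  λ x y x≢y → trans (multiplicity-++ N M x y) (cong₂ _+_ (uniformN x y x≢y) (uniformM x y x≢y))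

AdmitsCUNestedPairing-concat⁺ : ∀ {v} (B : List (Subset v)) (Bs : List (List (Subset v))) →
  All AdmitsCUNestedPairing (B ∷ Bs) → AdmitsCUNestedPairing (concat (B ∷ Bs))
AdmitsCUNestedPairing-concat⁺ B [] (admitsB ∷ []) =
  subst AdmitsCUNestedPairing (sym (++-identityʳ B)) admitsB
AdmitsCUNestedPairing-concat⁺ B (C ∷ Cs) (admitsB ∷ admitsCs) =
  AdmitsCUNestedPairing-++ admitsB (AdmitsCUNestedPairing-concat⁺ C Cs admitsCs)

AdmitsCUNestedPairing-resp-↭ : ∀ {v} {B C : List (Subset v)} →
  B ↭ C → AdmitsCUNestedPairing B → AdmitsCUNestedPairing C
AdmitsCUNestedPairing-resp-↭ B↭C (N , (validN , N⇒B) , m , 0<m , uniformN)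
  with N′ , C≡N′ , N↭N′ ← ↭-map-inv underlying (↭-trans (↭-reflexive N⇒B) B↭C) =
  N′ , (All-resp-↭ N↭N′ validN , sym C≡N′) , m , 0<m ,
  λ x y x≢y → trans (sym (multiplicity-resp-↭ N↭N′ x y)) (uniformN x y x≢y)

¬IsSQS-[] : ∀ {v} → 2 < v → ¬ IsSQS v []
¬IsSQS-[] (s≤s (s≤s (s≤s _))) (_ , onePerTriple)
  with () ← onePerTriple zero (suc zero) (suc (suc zero)) (λ ()) (λ ()) (λ ())

proposition3p4 : (v : ℕ) → v % 6 ≡ 2 → 2 < v →
    (B : List (Subset v)) → IsSQS v B →
    (Bs : List (List (Subset v))) → length Bs ≡ (v ∸ 2) / 6 → concat Bs ↭ B →
    All (λ Bh → Is2Design v 3 Bh × AdmitsCUNestedPairing Bh) Bs →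
    AdmitsCUNestedPairing B
proposition3p4 v _ 2<v B sqs [] _ []↭B _ with refl ← ↭-empty-inv (↭-sym []↭B) =
  ⊥-elim (¬IsSQS-[] 2<v sqs)
proposition3p4 v _ _ B _ (B₁ ∷ Bs) _ concat↭B classes =
  AdmitsCUNestedPairing-resp-↭ concat↭B
    (AdmitsCUNestedPairing-concat⁺ B₁ Bs (All.map proj₂ classes))
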